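{- Let $T$ be a tree of order $n$. Then $PRC(T)=n$ if and only if $T\in\{P_1,P_2,P_4\}$.
   Context: All graphs are simple, finite and undirected; $P_n$ is the path on $n$ vertices. A set $S\subseteq V(G)$ is a dominating set if every vertex not in $S$ has a neighbor in $S$; $S$ is a perfect dominating set if every vertex in $V(G)\setminus S$ has exactly one neighbor in $S$. A perfect coalition in $G$ consists of two disjoint sets $V_1,V_2$ of vertices such that (i) neither $V_1$ nor $V_2$ is a dominating set of $G$; (ii) each vertex in $V(G)\setminus V_1$ has at most one neighbor in $V_1$, and each vertex in $V(G)\setminus V_2$ has at most one neighbor in $V_2$; (iii) $V_1\cup V_2$ is a perfect dominating set of $G$. A perfect coalition partition ($prc$-partition) of $G$ is a vertex partition $\pi=\{V_1,\dots,V_k\}$ such that each $V_i$ either is a singleton dominating set or forms a perfect coalition with some $V_j\in\pi$. $PRC(G)$ is the maximum cardinality of a $prc$-partition of $G$, with $PRC(G)=0$ if $G$ has no $prc$-partition. -}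

module Defs where

open import Data.Nat using (ℕ; zero; suc; _+_; _≤_; _<_; _∸_)
open import Data.Fin using (Fin; toℕ; inject₁; fromℕ) renaming (zero to fzero; suc to fsuc)
open import Data.Bool using (Bool; true; false)
open import Data.Product using (Σ; ∃; _×_; _,_)
open import Data.Sum using (_⊎_)
open import Relation.Nullary using (¬_)
open import Relation.Binary.PropositionalEquality using (_≡_; _≢_; refl; sym; subst)
open import Data.Nat.Properties using (n∸n≡0)
open import Data.Empty using (⊥)
open import Function.Bundles using (_↔_; Inverse)
open import Function.Definitions using (Injective; Surjective)

record Graph (n : ℕ) : Set where
  field
    adj   : Fin n → Fin n → Bool
    adj-sym   : ∀ u v → adj u v ≡ adj v u
    irrefl : ∀ v → adj v v ≡ false
open Graph public

Adj : ∀ {n} → Graph n → Fin n → Fin n → Set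
Adj G u v = adj G u v ≡ true

data Walk {n : ℕ} (G : Graph n) : Fin n → Fin n → Set where
  here : ∀ {u} → Walk G u u
  step : ∀ {u v w} → Adj G u v → Walk G v w → Walk G u w

Connected : ∀ {n} → Graph n → Set
Connected G = ∀ u v → Walk G u v

record Cycle {n : ℕ} (G : Graph n) (m : ℕ) : Set where
  field
    vtx   : Fin (3 + m) → Fin n
    inj   : Injective _≡_ _≡_ vtx
    edges : ∀ (i : Fin (2 + m)) → Adj G (vtx (inject₁ i)) (vtx (fsuc i))
    close : Adj G (vtx (fromℕ (2 + m))) (vtx fzero)

Acyclic : ∀ {n} → Graph n → Set
Acyclic G = ∀ m → ¬ Cycle G m

IsTree : ∀ {n} → Graph n → Set
IsTree {n} G = (0 < n) × Connected G × Acyclic G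

-- The path P_m on vertices 0,...,m-1 with i ~ j iff |i - j| = 1.
dist1 : ℕ → ℕ → Bool
dist1 1 0 = true
dist1 0 1 = true
dist1 _ _ = false

dist1-sym : ∀ x y → dist1 x y ≡ dist1 y x
dist1-sym 0 0 = refl
dist1-sym 0 1 = refl
dist1-sym 0 (suc (suc y)) = refl
dist1-sym 1 0 = refl
dist1-sym 1 1 = refl
dist1-sym 1 (suc (suc y)) = refl
dist1-sym (suc (suc x)) 0 = refl
dist1-sym (suc (suc x)) 1 = refl
dist1-sym (suc (suc x)) (suc (suc y)) = refl

pathAdj : ∀ {m} → Fin m → Fin m → Bool
pathAdj i j = dist1 (toℕ i ∸ toℕ j) (toℕ j ∸ toℕ i)

P : (m : ℕ) → Graph m
P m = record
  { adj = pathAdj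
  ; adj-sym = λ u v → dist1-sym (toℕ u ∸ toℕ v) (toℕ v ∸ toℕ u)
  ; irrefl = λ v → subst (λ z → dist1 z z ≡ false) (sym (n∸n≡0 (toℕ v))) refl
  }

_≅_ : ∀ {n m} → Graph n → Graph m → Set
_≅_ {n} {m} G H = Σ (Fin n ↔ Fin m) λ σ →
  ∀ u v → adj G u v ≡ adj H (Inverse.to σ u) (Inverse.to σ v)

Subset : ℕ → Set₁
Subset n = Fin n → Set

Dominating : ∀ {n} → Graph n → Subset n → Set
Dominating G S = ∀ v → ¬ S v → ∃ λ u → S u × Adj G u v

AtMostOneNbr : ∀ {n} → Graph n → Subset n → Set
AtMostOneNbr G S = ∀ v → ¬ S v → ∀ u w → S u → S w → Adj G v u → Adj G v w → u ≡ w

PerfectDominating : ∀ {n} → Graph n → Subset n → Set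
PerfectDominating G S = Dominating G S × AtMostOneNbr G S

_∪_ : ∀ {n} → Subset n → Subset n → Subset n
(S ∪ T) v = S v ⊎ T v

PerfectCoalition : ∀ {n} → Graph n → Subset n → Subset n → Set
PerfectCoalition G V₁ V₂ =
  (∀ v → V₁ v → V₂ v → ⊥) ×
  ¬ Dominating G V₁ × ¬ Dominating G V₂ ×
  AtMostOneNbr G V₁ × AtMostOneNbr G V₂ ×
  PerfectDominating G (V₁ ∪ V₂)

-- A vertex partition into k (nonempty) classes, encoded as a surjection
-- f : Fin n → Fin k; the i-th class is f⁻¹(i).
Class : ∀ {n k} → (Fin n → Fin k) → Fin k → Subset n
Class f i v = f v ≡ i

Singleton : ∀ {n} → Subset n → Set
Singleton S = ∃ λ v → S v × (∀ u → S u → u ≡ v)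

IsPRCPartition : ∀ {n k} → Graph n → (Fin n → Fin k) → Set
IsPRCPartition {n} {k} G f =
  Surjective _≡_ _≡_ f ×
  (∀ i → (Singleton (Class f i) × Dominating G (Class f i))
         ⊎ (∃ λ j → j ≢ i × PerfectCoalition G (Class f i) (Class f j)))

HasPRCPartition : ∀ {n} → Graph n → ℕ → Set
HasPRCPartition {n} G k = Σ (Fin n → Fin k) λ f → IsPRCPartition G f

-- PRC(G) ≡ k : k is the maximum cardinality of a prc-partition,
-- or k = 0 and G has no prc-partition.
PRC≡ : ∀ {n} → Graph n → ℕ → Set
PRC≡ G k =
  (HasPRCPartition G k × (∀ k′ → HasPRCPartition G k′ → k′ ≤ k))
  ⊎ (k ≡ 0 × (∀ k′ → ¬ HasPRCPartition G k′))

{-# OPTIONS --safe #-}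
module Submission where

-- A prc-partition of an n-vertex graph into n classes consists of singletons, so PRC(G) = n says
-- exactly that every vertex v is universal or has a partner w ≠ v, both non-universal, such that
-- every other vertex is adjacent to exactly one of v and w.  In a tree with at least three
-- vertices no vertex is universal, and partners are either adjacent or joined through an edge
-- between their neighbourhoods; both configurations produce a non-universal leaf x with
-- neighbour y.  The partner w of x must then lie at distance 3 along a path x y z w, the partner
-- of z must be y, and any further vertex, being adjacent to w and to z or y, would close a
-- triangle or a square.  So the tree is the path x y z w.

open import Defs
open import Data.Nat using (ℕ; suc; _+_; _≤_)
open import Data.Nat.Properties using (1+n≰n)
open import Data.Bool using (true; false)
import Data.Bool as Bool
open import Data.Bool.Properties using (¬-not)
open import Data.Fin using (Fin; _≟_; punchOut; inject₁; fromℕ) renaming (zero to fzero; suc to fsuc)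
open import Data.Fin.Properties using (punchOut-injective; injective⇒≤; ¬∀⟶∃¬; any?)
open import Data.Vec using (Vec; []; _∷_; lookup; head; last)
open import Data.Vec.Membership.Propositional using (_∈_)
open import Data.Vec.Relation.Unary.Any using (here; there; index)
open import Data.Vec.Relation.Unary.Any.Properties using (lookup-index)
open import Data.Vec.Relation.Unary.AllPairs using ([]; _∷_)
open import Data.Vec.Relation.Unary.All using ([]; _∷_)
open import Data.Vec.Relation.Unary.Linked using (Linked; [-]; _∷_)
open import Data.Vec.Relation.Unary.Unique.Propositional using (Unique)
open import Data.Vec.Relation.Unary.Unique.Propositional.Properties using (lookup-injective)
open import Data.Product as Product using (∃; ∃₂; _×_; _,_; proj₁; proj₂)
open import Data.Sum as Sum using (_⊎_; inj₁; inj₂)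
open import Data.Empty using (⊥; ⊥-elim)
open import Relation.Nullary using (¬_; Dec; yes; no; contradiction; ¬?; _→-dec_; _⊎-dec_)
open import Relation.Unary using (Decidable; _≐_)
open import Relation.Binary.PropositionalEquality
open import Function.Base using (id; _∘_)
open import Function.Bundles using (_⇔_; mk⇔; Equivalence; Inverse; Injection; mk↔ₛ′)
open import Function.Definitions using (Injective; Surjective)
open import Function.Properties.Inverse using (↔⇒↣)

injective⇒surjective : ∀ {m} {f : Fin m → Fin m} → Injective _≡_ _≡_ f → ∀ w → ∃ λ y → f y ≡ w
injective⇒surjective {suc m} {f} f-injective w with any? (λ y → f y ≟ w)
... | yes hit = hit
... | no miss = contradiction (injective⇒≤ punchOut∘f-injective) 1+n≰n
  where
  punchOut∘f : Fin (suc m) → Fin m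
  punchOut∘f y = punchOut {i = w} (λ w≡fy → miss (y , sym w≡fy))
  punchOut∘f-injective : Injective _≡_ _≡_ punchOut∘f
  punchOut∘f-injective = f-injective ∘ punchOut-injective {i = w} _ _

section-injective : ∀ {m k} {f : Fin m → Fin k} (f-surjective : Surjective _≡_ _≡_ f) →
                    Injective _≡_ _≡_ (λ y → proj₁ (f-surjective y))
section-injective {f = f} f-surjective {x} {y} gx≡gy = begin
  x                          ≡⟨ sym (proj₂ (f-surjective x) refl) ⟩
  f (proj₁ (f-surjective x)) ≡⟨ cong f gx≡gy ⟩
  f (proj₁ (f-surjective y)) ≡⟨ proj₂ (f-surjective y) refl ⟩
  y                          ∎
  where open ≡-Reasoning

surjective⇒injective : ∀ {m} {f : Fin m → Fin m} → Surjective _≡_ _≡_ f → Injective _≡_ _≡_ f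
surjective⇒injective {m} {f} f-surjective {u} {v} fu≡fv = begin
  u         ≡⟨ sym (g∘f u) ⟩
  g (f u)   ≡⟨ cong g fu≡fv ⟩
  g (f v)   ≡⟨ g∘f v ⟩
  v         ∎
  where
  open ≡-Reasoning
  g : Fin m → Fin m
  g y = proj₁ (f-surjective y)
  g∘f : ∀ u → g (f u) ≡ u
  g∘f u with y , refl ← injective⇒surjective (section-injective f-surjective) u =
    cong g (proj₂ (f-surjective y) refl)

lookup-fromℕ : ∀ {a} {A : Set a} {k} (xs : Vec A (suc k)) → lookup xs (fromℕ k) ≡ last xs
lookup-fromℕ (x ∷ []) = refl
lookup-fromℕ (x ∷ y ∷ ys) = lookup-fromℕ (y ∷ ys)

lookup-linked : ∀ {a r} {A : Set a} {R : A → A → Set r} {k} {xs : Vec A (suc k)} →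
                Linked R xs → ∀ i → R (lookup xs (inject₁ i)) (lookup xs (fsuc i))
lookup-linked {xs = _ ∷ _ ∷ _} (r ∷ _) fzero = r
lookup-linked {xs = _ ∷ _ ∷ _} (_ ∷ rs) (fsuc i) = lookup-linked rs i

enumeration⇒≅ : ∀ {n m} {G : Graph n} {H : Graph m} (xs : Vec (Fin n) m) → Unique xs → (∀ z → z ∈ xs) →
                (∀ i j → adj G (lookup xs i) (lookup xs j) ≡ adj H i j) → G ≅ H
enumeration⇒≅ {G = G} {H} xs unique covered table =
  mk↔ₛ′ position (lookup xs) position∘lookup lookup∘position , adj≡
  where
  position : Fin _ → Fin _
  position z = index (covered z)
  lookup∘position : ∀ z → lookup xs (position z) ≡ z
  lookup∘position z = sym (lookup-index (covered z))
  position∘lookup : ∀ i → position (lookup xs i) ≡ i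
  position∘lookup i = lookup-injective unique _ _ (lookup∘position (lookup xs i))
  adj≡ : ∀ u v → adj G u v ≡ adj H (position u) (position v)
  adj≡ u v = begin
    adj G u v                                               ≡⟨ sym (cong₂ (adj G) (lookup∘position u)
                                                                                  (lookup∘position v)) ⟩
    adj G (lookup xs (position u)) (lookup xs (position v)) ≡⟨ table (position u) (position v) ⟩
    adj H (position u) (position v)                         ∎
    where open ≡-Reasoning

Universal : ∀ {n} → Graph n → Fin n → Set
Universal G v = ∀ u → u ≢ v → Adj G v u

PerfectPair : ∀ {n} → Graph n → Fin n → Fin n → Set
PerfectPair G v w = ∀ z → z ≢ v → z ≢ w → (Adj G v z ⊎ Adj G w z) × ¬ (Adj G v z × Adj G w z)

PerfectPartners : ∀ {n} → Graph n → Fin n → Fin n → Set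
PerfectPartners G v w = w ≢ v × ¬ Universal G v × ¬ Universal G w × PerfectPair G v w

SingletonPRC : ∀ {n} → Graph n → Set
SingletonPRC G = ∀ v → Universal G v ⊎ ∃ (PerfectPartners G v)

Pendant : ∀ {n} → Graph n → Fin n → Fin n → Set
Pendant G x y = Adj G x y × (∀ z → Adj G x z → z ≡ y)

pattern 0F = fzero
pattern 1F = fsuc fzero
pattern 2F = fsuc (fsuc fzero)
pattern 3F = fsuc (fsuc (fsuc fzero))

module GraphProperties {n} (G : Graph n) where

  Adj-sym : ∀ {u v} → Adj G u v → Adj G v u
  Adj-sym {u} {v} uv = trans (adj-sym G v u) uv

  Adj⇒≢ : ∀ {u v} → Adj G u v → u ≢ v
  Adj⇒≢ {u} uv refl with () ← trans (sym uv) (irrefl G u)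

  Adj? : ∀ u v → Dec (Adj G u v)
  Adj? u v = adj G u v Bool.≟ true

  ¬Adj⇒adj≡false : ∀ {u v} → ¬ Adj G u v → adj G u v ≡ false
  ¬Adj⇒adj≡false = ¬-not

  walk⇒boundaryEdge : ∀ {S : Subset n} → Decidable S → ∀ {u v} → S u → ¬ S v → Walk G u v →
                      ∃₂ λ x y → S x × ¬ S y × Adj G x y
  walk⇒boundaryEdge S? Su ¬Sv here = contradiction Su ¬Sv
  walk⇒boundaryEdge S? {u} Su ¬Sv (step {v = u′} uu′ walk) with S? u′
  ... | yes Su′ = walk⇒boundaryEdge S? Su′ ¬Sv walk
  ... | no ¬Su′ = u , u′ , Su , ¬Su′ , uu′

  ¬universal⇒nonNeighbour : ∀ {v} → ¬ Universal G v → ∃ λ u → u ≢ v × ¬ Adj G v u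
  ¬universal⇒nonNeighbour {v} ¬universal
    with u , ¬[u≢v→vu] ← ¬∀⟶∃¬ n _ (λ u → ¬? (u ≟ v) →-dec Adj? v u) ¬universal
    = u , (λ u≡v → ¬[u≢v→vu] (λ u≢v → contradiction u≡v u≢v)) , (λ vu → ¬[u≢v→vu] (λ _ → vu))

  perfectPair-sym : ∀ {v w} → PerfectPair G v w → PerfectPair G w v
  perfectPair-sym perfect z z≢w z≢v with covered , exclusive ← perfect z z≢v z≢w =
    Sum.swap covered , exclusive ∘ Product.swap

  inducedPath⇒≅P4 : ∀ {a b c d} → a ≢ c → a ≢ d → b ≢ d → (∀ u → u ∈ a ∷ b ∷ c ∷ d ∷ []) →
                    Adj G a b → Adj G b c → Adj G c d → ¬ Adj G a c → ¬ Adj G a d → ¬ Adj G b d →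
                    G ≅ P 4
  inducedPath⇒≅P4 {a} {b} {c} {d} a≢c a≢d b≢d covered ab bc cd ¬ac ¬ad ¬bd =
    enumeration⇒≅ {G = G} {H = P 4} (a ∷ b ∷ c ∷ d ∷ [])
      ((Adj⇒≢ ab ∷ a≢c ∷ a≢d ∷ []) ∷ (Adj⇒≢ bc ∷ b≢d ∷ []) ∷ (Adj⇒≢ cd ∷ []) ∷ [] ∷ [])
      covered table
    where
    table : ∀ i j → adj G (lookup (a ∷ b ∷ c ∷ d ∷ []) i) (lookup (a ∷ b ∷ c ∷ d ∷ []) j) ≡ adj (P 4) i j
    table 0F 0F = irrefl G a
    table 0F 1F = ab
    table 0F 2F = ¬Adj⇒adj≡false ¬ac
    table 0F 3F = ¬Adj⇒adj≡false ¬ad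
    table 1F 0F = Adj-sym ab
    table 1F 1F = irrefl G b
    table 1F 2F = bc
    table 1F 3F = ¬Adj⇒adj≡false ¬bd
    table 2F 0F = ¬Adj⇒adj≡false (¬ac ∘ Adj-sym)
    table 2F 1F = Adj-sym bc
    table 2F 2F = irrefl G c
    table 2F 3F = cd
    table 3F 0F = ¬Adj⇒adj≡false (¬ad ∘ Adj-sym)
    table 3F 1F = ¬Adj⇒adj≡false (¬bd ∘ Adj-sym)
    table 3F 2F = Adj-sym cd
    table 3F 3F = irrefl G d

  module _ (acyclic : Acyclic G) where

    acyclic⇒noClosedPath : ∀ {m} (xs : Vec (Fin n) (3 + m)) → Unique xs → Linked (Adj G) xs →
                           Adj G (last xs) (head xs) → ⊥
    acyclic⇒noClosedPath {m} xs@(_ ∷ _) unique linked closing = acyclic m record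
      { vtx   = lookup xs
      ; inj   = lookup-injective unique _ _
      ; edges = lookup-linked linked
      ; close = subst (λ x → Adj G x (head xs)) (sym (lookup-fromℕ xs)) closing
      }

    no-triangle : ∀ {x y z} → Adj G x y → Adj G y z → Adj G z x → ⊥
    no-triangle {x} {y} {z} xy yz zx = acyclic⇒noClosedPath (x ∷ y ∷ z ∷ [])
      ((Adj⇒≢ xy ∷ Adj⇒≢ (Adj-sym zx) ∷ []) ∷ (Adj⇒≢ yz ∷ []) ∷ [] ∷ [])
      (xy ∷ yz ∷ [-]) zx

    no-square : ∀ {x y z w} → x ≢ z → y ≢ w →
                Adj G x y → Adj G y z → Adj G z w → Adj G w x → ⊥
    no-square {x} {y} {z} {w} x≢z y≢w xy yz zw wx = acyclic⇒noClosedPath (x ∷ y ∷ z ∷ w ∷ [])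
      ((Adj⇒≢ xy ∷ x≢z ∷ Adj⇒≢ (Adj-sym wx) ∷ []) ∷ (Adj⇒≢ yz ∷ y≢w ∷ []) ∷ (Adj⇒≢ zw ∷ []) ∷ [] ∷ [])
      (xy ∷ yz ∷ zw ∷ [-]) wx

module _ {n} {G : Graph n} where
  open GraphProperties G

  dominating⇔universal : ∀ {S v} → S ≐ (_≡ v) → Dominating G S ⇔ Universal G v
  dominating⇔universal {S} {v} (S⊆v , v⊆S) = mk⇔ to from
    where
    to : Dominating G S → Universal G v
    to dominating u u≢v with s , Ss , su ← dominating u (u≢v ∘ S⊆v) = subst (λ s → Adj G s u) (S⊆v Ss) su
    from : Universal G v → Dominating G S
    from universal u ¬Su = v , v⊆S refl , universal u (¬Su ∘ v⊆S)

  atMostOneNbr-singleton : ∀ {S v} → S ≐ (_≡ v) → AtMostOneNbr G S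
  atMostOneNbr-singleton (S⊆v , _) _ _ _ _ Su Sw _ _ = trans (S⊆v Su) (sym (S⊆v Sw))

  module _ {S T : Subset n} {v w : Fin n} (S≐v : S ≐ (_≡ v)) (T≐w : T ≐ (_≡ w)) where

    private
      S⊆v : ∀ {u} → S u → u ≡ v
      S⊆v = proj₁ S≐v
      v⊆S : ∀ {u} → u ≡ v → S u
      v⊆S = proj₂ S≐v
      T⊆w : ∀ {u} → T u → u ≡ w
      T⊆w = proj₁ T≐w
      w⊆T : ∀ {u} → u ≡ w → T u
      w⊆T = proj₂ T≐w

    perfectDominating⇔perfectPair : w ≢ v → PerfectDominating G (S ∪ T) ⇔ PerfectPair G v w
    perfectDominating⇔perfectPair w≢v = mk⇔ to from
      where
      to : PerfectDominating G (S ∪ T) → PerfectPair G v w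
      to (dominating , atMostOne) z z≢v z≢w = covered (dominating z z∉) , exclusive
        where
        z∉ : ¬ (S ∪ T) z
        z∉ = Sum.[ z≢v ∘ S⊆v , z≢w ∘ T⊆w ]
        covered : ∃ (λ s → (S ∪ T) s × Adj G s z) → Adj G v z ⊎ Adj G w z
        covered (s , inj₁ Ss , sz) = inj₁ (subst (λ s → Adj G s z) (S⊆v Ss) sz)
        covered (s , inj₂ Ts , sz) = inj₂ (subst (λ s → Adj G s z) (T⊆w Ts) sz)
        exclusive : ¬ (Adj G v z × Adj G w z)
        exclusive (vz , wz) =
          w≢v (sym (atMostOne z z∉ v w (inj₁ (v⊆S refl)) (inj₂ (w⊆T refl)) (Adj-sym vz) (Adj-sym wz)))
      from : PerfectPair G v w → PerfectDominating G (S ∪ T)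
      from perfect = dominating , atMostOne
        where
        exactlyOne : ∀ {z} → ¬ (S ∪ T) z → (Adj G v z ⊎ Adj G w z) × ¬ (Adj G v z × Adj G w z)
        exactlyOne {z} z∉ = perfect z (z∉ ∘ inj₁ ∘ v⊆S) (z∉ ∘ inj₂ ∘ w⊆T)
        dominating : Dominating G (S ∪ T)
        dominating z z∉ with proj₁ (exactlyOne z∉)
        ... | inj₁ vz = v , inj₁ (v⊆S refl) , vz
        ... | inj₂ wz = w , inj₂ (w⊆T refl) , wz
        atMostOne : AtMostOneNbr G (S ∪ T)
        atMostOne z z∉ x y = which
          where
          which : (S ∪ T) x → (S ∪ T) y → Adj G z x → Adj G z y → x ≡ y
          which (inj₁ Sx) (inj₁ Sy) _ _ = trans (S⊆v Sx) (sym (S⊆v Sy))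
          which (inj₂ Tx) (inj₂ Ty) _ _ = trans (T⊆w Tx) (sym (T⊆w Ty))
          which (inj₁ Sx) (inj₂ Ty) zx zy with refl ← S⊆v Sx | refl ← T⊆w Ty =
            ⊥-elim (proj₂ (exactlyOne z∉) (Adj-sym zx , Adj-sym zy))
          which (inj₂ Tx) (inj₁ Sy) zx zy with refl ← T⊆w Tx | refl ← S⊆v Sy =
            ⊥-elim (proj₂ (exactlyOne z∉) (Adj-sym zy , Adj-sym zx))

    perfectCoalition⇔perfectPartners : PerfectCoalition G S T ⇔ PerfectPartners G v w
    perfectCoalition⇔perfectPartners = mk⇔ to from
      where
      to : PerfectCoalition G S T → PerfectPartners G v w
      to (disjoint , ¬dominatingS , ¬dominatingT , _ , _ , perfect) =
        w≢v ,
        ¬dominatingS ∘ Equivalence.from (dominating⇔universal S≐v) ,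
        ¬dominatingT ∘ Equivalence.from (dominating⇔universal T≐w) ,
        Equivalence.to (perfectDominating⇔perfectPair w≢v) perfect
        where
        w≢v : w ≢ v
        w≢v w≡v = disjoint v (v⊆S refl) (w⊆T (sym w≡v))
      from : PerfectPartners G v w → PerfectCoalition G S T
      from (w≢v , ¬universalV , ¬universalW , perfect) =
        (λ x Sx Tx → w≢v (trans (sym (T⊆w Tx)) (S⊆v Sx))) ,
        ¬universalV ∘ Equivalence.to (dominating⇔universal S≐v) ,
        ¬universalW ∘ Equivalence.to (dominating⇔universal T≐w) ,
        atMostOneNbr-singleton S≐v ,
        atMostOneNbr-singleton T≐w ,
        Equivalence.from (perfectDominating⇔perfectPair w≢v) perfect

  class-singleton : ∀ {k} {f : Fin n → Fin k} {w i} → Injective _≡_ _≡_ f → f w ≡ i → Class f i ≐ (_≡ w)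
  class-singleton {f = f} f-injective fw≡i =
    (λ fu≡i → f-injective (trans fu≡i (sym fw≡i))) , (λ u≡w → trans (cong f u≡w) fw≡i)

  isPRCPartition⇒singletonPRC : ∀ {k} {f : Fin n → Fin k} → IsPRCPartition G f → Injective _≡_ _≡_ f →
                                SingletonPRC G
  isPRCPartition⇒singletonPRC {f = f} (surjective , classes) f-injective v with classes (f v)
  ... | inj₁ (_ , dominating) =
    inj₁ (Equivalence.to (dominating⇔universal (class-singleton f-injective refl)) dominating)
  ... | inj₂ (j , _ , coalition) with w , fw≡j ← surjective j =
    inj₂ (w , Equivalence.to (perfectCoalition⇔perfectPartners (class-singleton f-injective refl)
                                                              (class-singleton f-injective (fw≡j refl)))
                             coalition)

  singletonPRC⇒isPRCPartition : SingletonPRC G → IsPRCPartition G id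
  singletonPRC⇒isPRCPartition singletonPRC = (λ i → i , id) , classes
    where
    classes : ∀ i → (Singleton (Class id i) × Dominating G (Class id i))
                    ⊎ ∃ λ j → j ≢ i × PerfectCoalition G (Class id i) (Class id j)
    classes i with singletonPRC i
    ... | inj₁ universal =
      inj₁ ((i , refl , λ _ → id) , Equivalence.from (dominating⇔universal (id , id)) universal)
    ... | inj₂ (w , partners) =
      inj₂ (w , proj₁ partners ,
            Equivalence.from (perfectCoalition⇔perfectPartners (id , id) (id , id)) partners)

  prc≤order : ∀ {k} → HasPRCPartition G k → k ≤ n
  prc≤order (_ , surjective , _) = injective⇒≤ (section-injective surjective)

  prc≡order⇔singletonPRC : PRC≡ G n ⇔ SingletonPRC G
  prc≡order⇔singletonPRC = mk⇔ to from
    where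
    to : PRC≡ G n → SingletonPRC G
    to (inj₁ ((_ , isPRC) , _)) = isPRCPartition⇒singletonPRC isPRC (surjective⇒injective (proj₁ isPRC))
    to (inj₂ (refl , _)) = λ ()
    from : SingletonPRC G → PRC≡ G n
    from singletonPRC = inj₁ ((id , singletonPRC⇒isPRCPartition singletonPRC) , λ _ → prc≤order)

module _ {n m} {G : Graph n} {H : Graph m} (G≅H : G ≅ H) where

  private
    σ : Fin n → Fin m
    σ = Inverse.to (proj₁ G≅H)
    τ : Fin m → Fin n
    τ = Inverse.from (proj₁ G≅H)
    σ∘τ : ∀ y → σ (τ y) ≡ y
    σ∘τ = Inverse.strictlyInverseˡ (proj₁ G≅H)
    σ-injective : Injective _≡_ _≡_ σ
    σ-injective = Injection.injective (↔⇒↣ (proj₁ G≅H))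

  ≅⇒Adj⇔ : ∀ {u v} → Adj G u v ⇔ Adj H (σ u) (σ v)
  ≅⇒Adj⇔ {u} {v} = mk⇔ (trans (sym (proj₂ G≅H u v))) (trans (proj₂ G≅H u v))

  ≅⇒universal⇔ : ∀ {v} → Universal G v ⇔ Universal H (σ v)
  ≅⇒universal⇔ {v} = mk⇔ to from
    where
    to : Universal G v → Universal H (σ v)
    to universal u u≢σv = subst (Adj H (σ v)) (σ∘τ u)
      (Equivalence.to ≅⇒Adj⇔ (universal (τ u) (λ τu≡v → u≢σv (trans (sym (σ∘τ u)) (cong σ τu≡v)))))
    from : Universal H (σ v) → Universal G v
    from universal u u≢v = Equivalence.from ≅⇒Adj⇔ (universal (σ u) (u≢v ∘ σ-injective))

  ≅-reflects-perfectPair : ∀ {v w} → PerfectPair H (σ v) (σ w) → PerfectPair G v w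
  ≅-reflects-perfectPair perfect z z≢v z≢w
    with covered , exclusive ← perfect (σ z) (z≢v ∘ σ-injective) (z≢w ∘ σ-injective) =
    Sum.map (Equivalence.from ≅⇒Adj⇔) (Equivalence.from ≅⇒Adj⇔) covered ,
    λ (vz , wz) → exclusive (Equivalence.to ≅⇒Adj⇔ vz , Equivalence.to ≅⇒Adj⇔ wz)

  ≅-reflects-singletonPRC : SingletonPRC H → SingletonPRC G
  ≅-reflects-singletonPRC singletonPRC v with singletonPRC (σ v)
  ... | inj₁ universal = inj₁ (Equivalence.from ≅⇒universal⇔ universal)
  ... | inj₂ (w , partners)
    with w≢σv , ¬universalV , ¬universalW , perfect ← subst (PerfectPartners H (σ v)) (sym (σ∘τ w)) partners =
    inj₂ (τ w , w≢σv ∘ cong σ , ¬universalV ∘ Equivalence.to ≅⇒universal⇔ ,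
               ¬universalW ∘ Equivalence.to ≅⇒universal⇔ , ≅-reflects-perfectPair perfect)

singletonPRC-P1 : SingletonPRC (P 1)
singletonPRC-P1 0F = inj₁ λ { 0F 0≢0 → contradiction refl 0≢0 }

singletonPRC-P2 : SingletonPRC (P 2)
singletonPRC-P2 0F = inj₁ λ { 0F 0≢0 → contradiction refl 0≢0 ; 1F _ → refl }
singletonPRC-P2 1F = inj₁ λ { 0F _ → refl ; 1F 1≢1 → contradiction refl 1≢1 }

¬universal-P4 : ∀ v → ¬ Universal (P 4) v
¬universal-P4 0F universal with () ← universal 2F (λ ())
¬universal-P4 1F universal with () ← universal 3F (λ ())
¬universal-P4 2F universal with () ← universal 0F (λ ())
¬universal-P4 3F universal with () ← universal 0F (λ ())

perfectPair-P4-ends : PerfectPair (P 4) 0F 3F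
perfectPair-P4-ends 0F 0≢0 _ = contradiction refl 0≢0
perfectPair-P4-ends 1F _ _ = inj₁ refl , λ ()
perfectPair-P4-ends 2F _ _ = inj₂ refl , λ ()
perfectPair-P4-ends 3F _ 3≢3 = contradiction refl 3≢3

perfectPair-P4-middle : PerfectPair (P 4) 1F 2F
perfectPair-P4-middle 0F _ _ = inj₁ refl , λ ()
perfectPair-P4-middle 1F 1≢1 _ = contradiction refl 1≢1
perfectPair-P4-middle 2F _ 2≢2 = contradiction refl 2≢2
perfectPair-P4-middle 3F _ _ = inj₂ refl , λ ()

singletonPRC-P4 : SingletonPRC (P 4)
singletonPRC-P4 0F = inj₂ (3F , (λ ()) , ¬universal-P4 0F , ¬universal-P4 3F , perfectPair-P4-ends)
singletonPRC-P4 1F = inj₂ (2F , (λ ()) , ¬universal-P4 1F , ¬universal-P4 2F , perfectPair-P4-middle)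
singletonPRC-P4 2F = inj₂ (1F , (λ ()) , ¬universal-P4 2F , ¬universal-P4 1F ,
                           GraphProperties.perfectPair-sym (P 4) perfectPair-P4-middle)
singletonPRC-P4 3F = inj₂ (0F , (λ ()) , ¬universal-P4 3F , ¬universal-P4 0F ,
                           GraphProperties.perfectPair-sym (P 4) perfectPair-P4-ends)

module TreeAnalysis {n} {G : Graph n} (connected : Connected G) (acyclic : Acyclic G)
                    (singletonPRC : SingletonPRC G) where
  open GraphProperties G

  perfectPartner : ∀ {v} → ¬ Universal G v → ∃ (PerfectPartners G v)
  perfectPartner {v} ¬universal with singletonPRC v
  ... | inj₁ universal = contradiction universal ¬universal
  ... | inj₂ partner = partner

  universal⇒order≤2 : ∀ {v u x} → Universal G v → u ≢ v → x ≢ v → x ≢ u → ⊥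
  universal⇒order≤2 {v} {u} {x} universalV u≢v x≢v x≢u with singletonPRC u
  ... | inj₁ universalU =
    no-triangle acyclic (universalV u u≢v) (universalU x x≢u) (Adj-sym (universalV x x≢v))
  ... | inj₂ (p , _ , _ , ¬universalP , perfect) with p ≟ v
  ...   | yes refl = ¬universalP universalV
  ...   | no p≢v = proj₂ (perfect v (u≢v ∘ sym) (p≢v ∘ sym))
                          (Adj-sym (universalV u u≢v) , Adj-sym (universalV p p≢v))

  module _ {x y w} (pendant : Pendant G x y) (w≢x : w ≢ x) (perfect : PerfectPair G x w)
           (¬universalW : ¬ Universal G w) where

    private
      xy : Adj G x y
      xy = proj₁ pendant
      onlyY : ∀ z → Adj G x z → z ≡ y
      onlyY = proj₂ pendant
      y≢x : y ≢ x
      y≢x = Adj⇒≢ xy ∘ sym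

      w≢y : w ≢ y
      w≢y refl = ¬universalW universalW
        where
        universalW : Universal G w
        universalW u u≢w with u ≟ x
        ... | yes refl = Adj-sym xy
        ... | no u≢x = Sum.[ (λ xu → contradiction (onlyY u xu) u≢w) , id ] (proj₁ (perfect u u≢x u≢w))

      ¬yw : ¬ Adj G y w
      ¬yw yw = proj₂ (perfect y y≢x (w≢y ∘ sym)) (xy , Adj-sym yw)

      adjacentToW : ∀ {u} → u ≢ x → u ≢ y → u ≢ w → Adj G w u
      adjacentToW {u} u≢x u≢y u≢w =
        Sum.[ (λ xu → contradiction (onlyY u xu) u≢y) , id ] (proj₁ (perfect u u≢x u≢w))

      exit : ∃ λ z → z ≢ x × z ≢ y × Adj G y z
      exit with walk⇒boundaryEdge {S = λ u → u ≡ x ⊎ u ≡ y} (λ u → (u ≟ x) ⊎-dec (u ≟ y))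
                                  (inj₁ refl) Sum.[ w≢x , w≢y ] (connected x w)
      ... | _ , z , inj₁ refl , z∉ , xz = contradiction (inj₂ (onlyY z xz)) z∉
      ... | _ , z , inj₂ refl , z∉ , yz = z , z∉ ∘ inj₁ , z∉ ∘ inj₂ , yz

    module _ {z} (z≢x : z ≢ x) (z≢y : z ≢ y) (yz : Adj G y z) where

      private
        z≢w : z ≢ w
        z≢w z≡w = ¬yw (subst (Adj G y) z≡w yz)
        wz : Adj G w z
        wz = adjacentToW z≢x z≢y z≢w

        ¬universalZ : ¬ Universal G z
        ¬universalZ universalZ = z≢y (onlyY z (Adj-sym (universalZ x (z≢x ∘ sym))))

        perfectZY : PerfectPair G z y
        perfectZY = partnerIsY (perfectPartner ¬universalZ)
          where
          partnerIsY : ∃ (PerfectPartners G z) → PerfectPair G z y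
          partnerIsY (p , _ , _ , _ , perfectZP) = subst (PerfectPair G z) p≡y perfectZP
            where
            p≡y : p ≡ y
            p≡y with p ≟ x
            ... | yes refl = contradiction (Adj-sym yz , xy) (proj₂ (perfectZP y (z≢y ∘ sym) y≢x))
            ... | no p≢x = Sum.[ (λ zx → contradiction (onlyY z (Adj-sym zx)) z≢y) ,
                                 (λ px → onlyY p (Adj-sym px)) ]
                                 (proj₁ (perfectZP x (z≢x ∘ sym) (p≢x ∘ sym)))

        covered : ∀ u → u ∈ x ∷ y ∷ z ∷ w ∷ []
        covered u with u ≟ x | u ≟ y | u ≟ z | u ≟ w
        ... | yes u≡x | _ | _ | _ = here u≡x
        ... | no _ | yes u≡y | _ | _ = there (here u≡y)
        ... | no _ | no _ | yes u≡z | _ = there (there (here u≡z))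
        ... | no _ | no _ | no _ | yes u≡w = there (there (there (here u≡w)))
        ... | no u≢x | no u≢y | no u≢z | no u≢w with adjacentToW u≢x u≢y u≢w | proj₁ (perfectZY u u≢z u≢y)
        ...   | wu | inj₁ zu = ⊥-elim (no-triangle acyclic zu (Adj-sym wu) wz)
        ...   | wu | inj₂ yu = ⊥-elim (no-square acyclic (w≢y ∘ sym) u≢z yu (Adj-sym wu) wz (Adj-sym yz))

      pendantPath⇒≅P4 : G ≅ P 4
      pendantPath⇒≅P4 = inducedPath⇒≅P4 (z≢x ∘ sym) (w≢x ∘ sym) (w≢y ∘ sym) covered xy yz (Adj-sym wz)
                          (λ xz → z≢y (onlyY z xz)) (λ xw → w≢y (onlyY w xw)) ¬yw

    pendantPartners⇒≅P4 : G ≅ P 4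
    pendantPartners⇒≅P4 with z , z≢x , z≢y , yz ← exit = pendantPath⇒≅P4 z≢x z≢y yz

  pendant⇒≅P4 : ∀ {x y} → Pendant G x y → ¬ Universal G x → G ≅ P 4
  pendant⇒≅P4 pendant ¬universalX with w , w≢x , _ , ¬universalW , perfect ← perfectPartner ¬universalX =
    pendantPartners⇒≅P4 pendant w≢x perfect ¬universalW

  adjacentPartners⇒pendant : ∀ {v w} → Adj G v w → PerfectPair G v w → ¬ Universal G v →
                             ∃ λ a → Pendant G a w × ¬ Universal G a
  adjacentPartners⇒pendant {v} {w} vw perfect ¬universalV
    with a , a≢v , ¬va ← ¬universal⇒nonNeighbour ¬universalV =
    a , (Adj-sym wa , onlyW) , λ universalA → ¬va (Adj-sym (universalA v (a≢v ∘ sym)))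
    where
    a≢w : a ≢ w
    a≢w a≡w = ¬va (subst (Adj G v) (sym a≡w) vw)
    wa : Adj G w a
    wa = Sum.[ (λ va → contradiction va ¬va) , id ] (proj₁ (perfect a a≢v a≢w))
    onlyW : ∀ z → Adj G a z → z ≡ w
    onlyW z az with z ≟ w
    ... | yes z≡w = z≡w
    ... | no z≢w with proj₁ (perfect z (λ z≡v → ¬va (Adj-sym (subst (Adj G a) z≡v az))) z≢w)
    ...   | inj₁ vz = ⊥-elim (no-square acyclic a≢v z≢w az (Adj-sym vz) vw wa)
    ...   | inj₂ wz = ⊥-elim (no-triangle acyclic az (Adj-sym wz) wa)

  module _ {v w} (¬vw : ¬ Adj G v w) (w≢v : w ≢ v) (perfect : PerfectPair G v w) where

    private
      bridge : ∃₂ λ a b → b ≢ v × Adj G v a × Adj G a b × ¬ Adj G v b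
      bridge with walk⇒boundaryEdge {S = λ u → u ≡ v ⊎ Adj G v u} (λ u → (u ≟ v) ⊎-dec Adj? v u)
                                    (inj₁ refl) Sum.[ w≢v , ¬vw ] (connected v w)
      ... | _ , b , inj₁ refl , b∉ , vb = contradiction (inj₂ vb) b∉
      ... | a , b , inj₂ va , b∉ , ab = a , b , b∉ ∘ inj₁ , va , ab , b∉ ∘ inj₂

    module _ {a b} (b≢v : b ≢ v) (va : Adj G v a) (ab : Adj G a b) (¬vb : ¬ Adj G v b) where

      private
        a≢v : a ≢ v
        a≢v = Adj⇒≢ va ∘ sym
        a≢w : a ≢ w
        a≢w a≡w = ¬vw (subst (Adj G v) a≡w va)
        ¬wa : ¬ Adj G w a
        ¬wa wa = proj₂ (perfect a a≢v a≢w) (va , wa)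
        b≢w : b ≢ w
        b≢w b≡w = ¬wa (Adj-sym (subst (Adj G a) b≡w ab))
        wb : Adj G w b
        wb = Sum.[ (λ vb → contradiction vb ¬vb) , id ] (proj₁ (perfect b b≢v b≢w))

        ¬universalA : ¬ Universal G a
        ¬universalA universalA = ¬wa (Adj-sym (universalA w (a≢w ∘ sym)))

        -- The partner p of a is a neighbour of w, so a second neighbour q of v, being adjacent
        -- to a or to p, would close the triangle v a q or the hexagon v a b w p q.
        separatedPartner⇒pendant : ∀ {p} → ¬ Adj G a p → PerfectPair G a p → p ≢ a → Pendant G v a
        separatedPartner⇒pendant {p} ¬ap perfectAP p≢a = va , onlyA
          where
          b≢p : b ≢ p
          b≢p b≡p = ¬ap (subst (Adj G a) b≡p ab)
          p≢w : p ≢ w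
          p≢w refl = proj₂ (perfectAP b (Adj⇒≢ ab ∘ sym) b≢p) (ab , wb)
          wp : Adj G w p
          wp = Sum.[ (λ aw → contradiction (Adj-sym aw) ¬wa) , Adj-sym ]
                     (proj₁ (perfectAP w (a≢w ∘ sym) (p≢w ∘ sym)))
          p≢v : p ≢ v
          p≢v p≡v = ¬vw (Adj-sym (subst (Adj G w) p≡v wp))
          ¬vp : ¬ Adj G v p
          ¬vp vp = proj₂ (perfect p p≢v p≢w) (vp , wp)
          onlyA : ∀ q → Adj G v q → q ≡ a
          onlyA q vq with q ≟ a
          ... | yes q≡a = q≡a
          ... | no q≢a with proj₁ (perfectAP q q≢a (λ q≡p → ¬vp (subst (Adj G v) q≡p vq)))
          ...   | inj₁ aq = ⊥-elim (no-triangle acyclic va aq (Adj-sym vq))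
          ...   | inj₂ pq = ⊥-elim (acyclic⇒noClosedPath acyclic (v ∷ a ∷ b ∷ w ∷ p ∷ q ∷ [])
                                      distinct (va ∷ ab ∷ Adj-sym wb ∷ wp ∷ pq ∷ [-]) (Adj-sym vq))
            where
            distinct : Unique (v ∷ a ∷ b ∷ w ∷ p ∷ q ∷ [])
            distinct = (Adj⇒≢ va ∷ b≢v ∘ sym ∷ w≢v ∘ sym ∷ p≢v ∘ sym ∷ Adj⇒≢ vq ∷ [])
                     ∷ (Adj⇒≢ ab ∷ a≢w ∷ p≢a ∘ sym ∷ q≢a ∘ sym ∷ [])
                     ∷ (b≢w ∷ b≢p ∷ (λ b≡q → ¬vb (subst (Adj G v) (sym b≡q) vq)) ∷ [])
                     ∷ (Adj⇒≢ wp ∷ (λ w≡q → ¬vw (subst (Adj G v) (sym w≡q) vq)) ∷ [])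
                     ∷ (Adj⇒≢ pq ∷ [])
                     ∷ [] ∷ []

      bridge⇒≅P4 : G ≅ P 4
      bridge⇒≅P4 = viaPartnerOfA (perfectPartner ¬universalA)
        where
        viaPartnerOfA : ∃ (PerfectPartners G a) → G ≅ P 4
        viaPartnerOfA (p , p≢a , _ , _ , perfectAP) with Adj? a p
        ... | yes ap with c , pendantC , ¬universalC ← adjacentPartners⇒pendant ap perfectAP ¬universalA =
          pendant⇒≅P4 pendantC ¬universalC
        ... | no ¬ap =
          pendant⇒≅P4 (separatedPartner⇒pendant ¬ap perfectAP p≢a) (λ universalV → ¬vw (universalV w w≢v))

    separatedPartners⇒≅P4 : G ≅ P 4
    separatedPartners⇒≅P4 with a , b , b≢v , va , ab , ¬vb ← bridge = bridge⇒≅P4 b≢v va ab ¬vb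

  threeVertices⇒≅P4 : ∀ {v u x} → u ≢ v → x ≢ v → x ≢ u → G ≅ P 4
  threeVertices⇒≅P4 {v} u≢v x≢v x≢u with singletonPRC v
  ... | inj₁ universalV = ⊥-elim (universal⇒order≤2 universalV u≢v x≢v x≢u)
  ... | inj₂ (w , w≢v , ¬universalV , _ , perfect) with Adj? v w
  ...   | no ¬vw = separatedPartners⇒≅P4 ¬vw w≢v perfect
  ...   | yes vw with a , pendantA , ¬universalA ← adjacentPartners⇒pendant vw perfect ¬universalV =
    pendant⇒≅P4 pendantA ¬universalA

tree-singletonPRC⇒≅path : ∀ {n} {T : Graph n} → IsTree T → SingletonPRC T →
                          (T ≅ P 1) ⊎ (T ≅ P 2) ⊎ (T ≅ P 4)
tree-singletonPRC⇒≅path {0} (() , _)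
tree-singletonPRC⇒≅path {1} {T} _ _ =
  inj₁ (enumeration⇒≅ {G = T} {H = P 1} (0F ∷ []) ([] ∷ []) (λ { 0F → here refl }) λ { 0F 0F → irrefl T 0F })
tree-singletonPRC⇒≅path {2} {T} (_ , connected , _) _ =
  inj₂ (inj₁ (enumeration⇒≅ {G = T} {H = P 2} (0F ∷ 1F ∷ []) (((λ ()) ∷ []) ∷ [] ∷ [])
                            (λ { 0F → here refl ; 1F → there (here refl) }) table))
  where
  edge : Walk T 0F 1F → Adj T 0F 1F
  edge (step {v = 0F} loop _) = contradiction (trans (sym loop) (irrefl T 0F)) λ ()
  edge (step {v = 1F} e _) = e
  table : ∀ i j → adj T (lookup (0F ∷ 1F ∷ []) i) (lookup (0F ∷ 1F ∷ []) j) ≡ adj (P 2) i j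
  table 0F 0F = irrefl T 0F
  table 0F 1F = edge (connected 0F 1F)
  table 1F 0F = GraphProperties.Adj-sym T (edge (connected 0F 1F))
  table 1F 1F = irrefl T 1F
tree-singletonPRC⇒≅path {suc (suc (suc _))} (_ , connected , acyclic) singletonPRC =
  inj₂ (inj₂ (TreeAnalysis.threeVertices⇒≅P4 connected acyclic singletonPRC {v = 0F} {1F} {2F}
                                              (λ ()) (λ ()) (λ ())))

corollary4p7 : ∀ (n : ℕ) (T : Graph n) → IsTree T →
    (PRC≡ T n → (T ≅ P 1) ⊎ (T ≅ P 2) ⊎ (T ≅ P 4))
    × ((T ≅ P 1) ⊎ (T ≅ P 2) ⊎ (T ≅ P 4) → PRC≡ T n)
corollary4p7 n T tree =
  tree-singletonPRC⇒≅path tree ∘ Equivalence.to characterisation ,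
  Equivalence.from characterisation ∘ Sum.[ reflect (P 1) singletonPRC-P1 ,
                                      Sum.[ reflect (P 2) singletonPRC-P2 , reflect (P 4) singletonPRC-P4 ] ]
  where
  characterisation : PRC≡ T n ⇔ SingletonPRC T
  characterisation = prc≡order⇔singletonPRC {G = T}
  reflect : ∀ {m} (H : Graph m) → SingletonPRC H → T ≅ H → SingletonPRC T
  reflect H singletonPRC T≅H = ≅-reflects-singletonPRC {G = T} {H = H} T≅H singletonPRC
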